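{- Every satisfiable $\mathsf{BST}^{\otimes}$-conjunction with $n$ variables is fulfilled by an accessible $\otimes$-graph of size at most $2^{n}-1$.
   Context: Sets are elements of the von Neumann universe of well-founded sets. For sets $s,t$, $s\otimes t:=\{\{u,v\} : u\in s,\ v\in t\}$. A $\mathsf{BST}^{\otimes}$-conjunction is a finite conjunction of literals $x=y\cup z$, $x=y\setminus z$, $x=y\otimes z$, $x\neq y$ ($x,y,z$ set variables); it is satisfiable if some assignment of well-founded sets to its variables makes all literals true. A $\otimes$-graph $\mathcal{G}=(\mathcal{P},\mathcal{N},\mathcal{T})$: a set of places $\mathcal{P}$, nodes $\mathcal{N}=\mathcal{P}\otimes\mathcal{P}$ (nonempty subsets of $\mathcal{P}$ of size at most 2), $\mathcal{P}\cap\mathcal{N}=\emptyset$, and a target map $\mathcal{T}:\mathcal{N}\to\mathcal{P}(\mathcal{P})$; size $=|\mathcal{P}|$. Source places are places in no $\mathcal{T}(B)$. Accessible places form the least set containing the source places and containing $\mathcal{T}(B)$ whenever all places of node $B$ are in it; $\mathcal{G}$ is accessible if all places are accessible. An accessible $\mathcal{G}$ fulfills a conjunction $\Phi$ if there is $\mathfrak{F}:\mathrm{Vars}(\Phi)\to\mathcal{P}(\mathcal{P})$ with: (a) $\mathfrak{F}(x)=\mathfrak{F}(y)\star\mathfrak{F}(z)$ for each conjunct $x=y\star z$, $\star\in\{\cup,\setminus\}$; (b) $\mathfrak{F}(x)\ne\mathfrak{F}(y)$ for each conjunct $x\neq y$; (c) for each conjunct $x=y\otimes z$: (c1) $\emptyset\neq\mathcal{T}(\{\upsilon,\zeta\})\subseteq\mathfrak{F}(x)$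 for all $\upsilon\in\mathfrak{F}(y),\zeta\in\mathfrak{F}(z)$; (c2) $\mathfrak{F}(x)\subseteq\bigcup\{\mathcal{T}(B):B\in\mathfrak{F}(y)\otimes\mathfrak{F}(z)\}$; (c3) $\bigcup\{\mathcal{T}(B):B\in\mathcal{N}\setminus(\mathfrak{F}(y)\otimes\mathfrak{F}(z))\}\cap\mathfrak{F}(x)=\emptyset$. -}

module Defs where

open import Data.Nat using (ℕ; _≤_; _^_; _∸_)
open import Data.Fin using (Fin)
open import Data.Fin.Subset using (Subset; _∈_; _∉_; _⊆_; Nonempty; _∪_; _─_)
open import Data.Bool using (Bool; true; false)
open import Data.Product using (Σ; ∃; ∃-syntax; _×_; _,_; proj₁)
open import Data.Sum using (_⊎_; inj₁; inj₂)
open import Data.List using (List)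
open import Data.List.Relation.Unary.All using (All)
open import Relation.Nullary using (¬_)
open import Relation.Binary.PropositionalEquality using (_≡_; _≢_)

-- Well-founded sets: Aczel's model (iterative sets as well-founded trees),
-- with extensional equality.

data V : Set₁ where
  sup : (A : Set) → (A → V) → V

infix 4 _≐_ _∈ᵥ_

_≐_ : V → V → Set
sup A f ≐ sup B g = (∀ a → ∃[ b ] (f a ≐ g b)) × (∀ b → ∃[ a ] (f a ≐ g b))

_∈ᵥ_ : V → V → Set
x ∈ᵥ sup A f = ∃[ a ] (x ≐ f a)

_∪ᵥ_ : V → V → V
sup A f ∪ᵥ sup B g = sup (A ⊎ B) λ { (inj₁ a) → f a ; (inj₂ b) → g b }

_∖ᵥ_ : V → V → V
sup A f ∖ᵥ t = sup (Σ A λ a → ¬ (f a ∈ᵥ t)) (λ p → f (proj₁ p))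

pairᵥ : V → V → V
pairᵥ u v = sup Bool λ { true → u ; false → v }

_⊗ᵥ_ : V → V → V
sup A f ⊗ᵥ sup B g = sup (A × B) λ { (a , b) → pairᵥ (f a) (g b) }

data Literal (n : ℕ) : Set where
  unionL : Fin n → Fin n → Fin n → Literal n
  diffL  : Fin n → Fin n → Fin n → Literal n
  otimesL : Fin n → Fin n → Fin n → Literal n
  neqL   : Fin n → Fin n → Literal n

Conjunction : ℕ → Set
Conjunction n = List (Literal n)

HoldsV : ∀ {n} → (Fin n → V) → Literal n → Set
HoldsV M (unionL x y z) = M x ≐ (M y ∪ᵥ M z)
HoldsV M (diffL x y z) = M x ≐ (M y ∖ᵥ M z)
HoldsV M (otimesL x y z) = M x ≐ (M y ⊗ᵥ M z)
HoldsV M (neqL x y) = ¬ (M x ≐ M y)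

Satisfiable : ∀ {n} → Conjunction n → Set₁
Satisfiable {n} Φ = ∃[ M ] All (HoldsV {n} M) Φ

-- A node is an unordered pair {i , j}
-- (possibly i = j, i.e. a singleton); the target map on nodes is
-- represented by a symmetric function T : Fin m → Fin m → Subset m,
-- T i j standing for 𝒯({i , j}).

Target : ℕ → Set
Target m = Fin m → Fin m → Subset m

Symmetric : ∀ {m} → Target m → Set
Symmetric T = ∀ i j → T i j ≡ T j i

IsSource : ∀ {m} → Target m → Fin m → Set
IsSource T p = ∀ i j → p ∉ T i j

data Accessible {m : ℕ} (T : Target m) : Fin m → Set where
  source : ∀ {p} → IsSource T p → Accessible T p
  step   : ∀ {i j p} → Accessible T i → Accessible T j → p ∈ T i j → Accessible T p

AccessibleGraph : ∀ {m} → Target m → Set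
AccessibleGraph T = ∀ p → Accessible T p

NodeIn⊗ : ∀ {m} → Subset m → Subset m → Fin m → Fin m → Set
NodeIn⊗ Y Z u v = (u ∈ Y × v ∈ Z) ⊎ (v ∈ Y × u ∈ Z)

FulfillsLit : ∀ {n m} → Target m → (Fin n → Subset m) → Literal n → Set
FulfillsLit T F (unionL x y z) = F x ≡ F y ∪ F z
FulfillsLit T F (diffL x y z) = F x ≡ F y ─ F z
FulfillsLit T F (otimesL x y z) =
  (∀ u v → u ∈ F y → v ∈ F z → Nonempty (T u v) × T u v ⊆ F x)
  × (∀ p → p ∈ F x → ∃[ u ] ∃[ v ] (u ∈ F y × v ∈ F z × p ∈ T u v))
  × (∀ u v p → ¬ NodeIn⊗ (F y) (F z) u v → p ∈ T u v → p ∉ F x)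
FulfillsLit T F (neqL x y) = F x ≢ F y

Fulfills : ∀ {n m} → Target m → Conjunction n → Set
Fulfills {n} {m} T Φ = ∃[ F ] All (FulfillsLit {n} {m} T F) Φ

{-# OPTIONS --safe #-}
-- Places are the nonempty Venn regions of a model M: classes of elements of
-- the sets M x that lie in exactly the same M j's; there are at most 2^n − 1
-- of them.  A variable x is mapped to the regions meeting M x, and a region
-- r is a target of the node {u , v} when some literal x = y ⊗ z has in M x a
-- pair, lying in r, of an element of M y in u and an element of M z in v.
-- Union, difference and disequality transfer because membership in each M x
-- depends only on the region; the ⊗-conditions because pairs determine their
-- components.  A targeted region lies inside some M y ⊗ M z, so each of its
-- elements is a pair whose components lie in regions reaching it through a
-- node; ∈-induction then makes every place accessible.
module Submission where

open import Defs
open import Data.Nat using (ℕ; suc; _≤_; _^_; _∸_)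
open import Data.Nat.Properties using (≤-refl)
open import Data.Fin using (Fin; zero; suc; punchOut; combine)
open import Data.Fin.Properties using (punchOut-cong; punchOut-injective; combine-injective)
open import Data.Fin.Subset using (Subset; _∈_; _∉_; _⊆_; Nonempty; _∪_; _─_; ⊥; inside; outside)
open import Data.Fin.Subset.Properties using (⊆-antisym; ⊆-reflexive; x∈p∪q⁺; x∈p∪q⁻; ∉⊥)
open import Data.Vec using ([]; _∷_; tabulate; here; there)
open import Data.Vec.Properties using (lookup∘tabulate; []=⇒lookup; lookup⇒[]=)
open import Data.Bool using (Bool; true; false)
open import Data.Product using (Σ; ∃; ∃₂; ∃-syntax; _×_; _,_)
open import Data.Sum as Sum using (_⊎_; inj₁; inj₂)
open import Data.Empty using (⊥-elim)
open import Data.List.Relation.Unary.All as All using (All)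
open import Function using (_∘_)
open import Relation.Nullary using (¬_; yes; no; does)
open import Relation.Nullary.Decidable using (dec-true)
open import Relation.Binary.PropositionalEquality using (_≡_; _≢_; refl; sym; trans; cong; subst)
open import Level using (0ℓ)
open import Axiom.ExcludedMiddle using (ExcludedMiddle)

idx : V → Set
idx (sup A _) = A

el : (X : V) → idx X → V
el (sup _ f) = f

≐-refl : ∀ {x} → x ≐ x
≐-refl {sup A f} = (λ a → a , ≐-refl) , (λ a → a , ≐-refl)

≐-sym : ∀ {x y} → x ≐ y → y ≐ x
≐-sym {sup A f} {sup B g} (l , r) =
  (λ b → let (a , e) = r b in a , ≐-sym e) , (λ a → let (b , e) = l a in b , ≐-sym e)

≐-trans : ∀ {x y z} → x ≐ y → y ≐ z → x ≐ z
≐-trans {sup A f} {sup B g} {sup C h} (l₁ , r₁) (l₂ , r₂) =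
  (λ a → let (b , e₁) = l₁ a ; (c , e₂) = l₂ b in c , ≐-trans e₁ e₂) ,
  (λ c → let (b , e₂) = r₂ c ; (a , e₁) = r₁ b in a , ≐-trans e₁ e₂)

el-∈ : ∀ X (a : idx X) → el X a ∈ᵥ X
el-∈ (sup A f) a = a , ≐-refl

∈ᵥ⇒el : ∀ {w} X → w ∈ᵥ X → Σ (idx X) λ a → w ≐ el X a
∈ᵥ⇒el (sup A f) w∈ = w∈

∈ᵥ-respˡ : ∀ {w w′ X} → w ≐ w′ → w ∈ᵥ X → w′ ∈ᵥ X
∈ᵥ-respˡ {X = sup A f} e (a , e′) = a , ≐-trans (≐-sym e) e′

∈ᵥ-respʳ : ∀ {w X Y} → X ≐ Y → w ∈ᵥ X → w ∈ᵥ Y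
∈ᵥ-respʳ {X = sup A f} {sup B g} (l , r) (a , e) = let (b , e′) = l a in b , ≐-trans e e′

≐-ext : ∀ {X Y} → (∀ {w} → w ∈ᵥ X → w ∈ᵥ Y) → (∀ {w} → w ∈ᵥ Y → w ∈ᵥ X) → X ≐ Y
≐-ext {sup A f} {sup B g} X⊆Y Y⊆X =
  (λ a → X⊆Y (a , ≐-refl)) , (λ b → let (a , e) = Y⊆X (b , ≐-refl) in a , ≐-sym e)

∈-∪ᵥ⁻ : ∀ {w} X Y → w ∈ᵥ X ∪ᵥ Y → w ∈ᵥ X ⊎ w ∈ᵥ Y
∈-∪ᵥ⁻ (sup A f) (sup B g) (inj₁ a , e) = inj₁ (a , e)
∈-∪ᵥ⁻ (sup A f) (sup B g) (inj₂ b , e) = inj₂ (b , e)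

∈-∪ᵥ⁺ : ∀ {w} X Y → w ∈ᵥ X ⊎ w ∈ᵥ Y → w ∈ᵥ X ∪ᵥ Y
∈-∪ᵥ⁺ (sup A f) (sup B g) (inj₁ (a , e)) = inj₁ a , e
∈-∪ᵥ⁺ (sup A f) (sup B g) (inj₂ (b , e)) = inj₂ b , e

∈-∖ᵥ⁻ : ∀ {w} X Y → w ∈ᵥ X ∖ᵥ Y → w ∈ᵥ X × ¬ w ∈ᵥ Y
∈-∖ᵥ⁻ (sup A f) Y ((a , fa∉Y) , e) = (a , e) , fa∉Y ∘ ∈ᵥ-respˡ e

∈-∖ᵥ⁺ : ∀ {w} X Y → w ∈ᵥ X → ¬ w ∈ᵥ Y → w ∈ᵥ X ∖ᵥ Y
∈-∖ᵥ⁺ (sup A f) Y (a , e) w∉Y = (a , w∉Y ∘ ∈ᵥ-respˡ (≐-sym e)) , e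

pairᵥ-cong : ∀ {a b c d} → a ≐ c → b ≐ d → pairᵥ a b ≐ pairᵥ c d
pairᵥ-cong a≐c b≐d =
  (λ { true → true , a≐c ; false → false , b≐d }) ,
  (λ { true → true , a≐c ; false → false , b≐d })

pairᵥ-comm : ∀ a b → pairᵥ a b ≐ pairᵥ b a
pairᵥ-comm a b =
  (λ { true → false , ≐-refl ; false → true , ≐-refl }) ,
  (λ { true → false , ≐-refl ; false → true , ≐-refl })

pairᵥ-injective : ∀ {a b c d} → pairᵥ a b ≐ pairᵥ c d → (a ≐ c × b ≐ d) ⊎ (a ≐ d × b ≐ c)
pairᵥ-injective (l , r) with l true | l false
... | true  , a≐c | false , b≐d = inj₁ (a≐c , b≐d)
... | false , a≐d | true  , b≐c = inj₂ (a≐d , b≐c)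
... | true  , a≐c | true  , b≐c with r false
...   | true  , a≐d = inj₁ (a≐c , ≐-trans b≐c (≐-trans (≐-sym a≐c) a≐d))
...   | false , b≐d = inj₁ (a≐c , b≐d)
pairᵥ-injective (l , r) | false , a≐d | false , b≐d with r true
...   | true  , a≐c = inj₁ (a≐c , b≐d)
...   | false , b≐c = inj₂ (a≐d , b≐c)

∈-pairᵥˡ : ∀ a b → a ∈ᵥ pairᵥ a b
∈-pairᵥˡ a b = true , ≐-refl

∈-pairᵥʳ : ∀ a b → b ∈ᵥ pairᵥ a b
∈-pairᵥʳ a b = false , ≐-refl

∈-⊗ᵥ⁻ : ∀ {w} X Y → w ∈ᵥ X ⊗ᵥ Y →
         Σ (idx X) λ a → Σ (idx Y) λ b → w ≐ pairᵥ (el X a) (el Y b)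
∈-⊗ᵥ⁻ (sup A f) (sup B g) ((a , b) , e) = a , b , e

∈-⊗ᵥ⁺ : ∀ {a b} X Y → a ∈ᵥ X → b ∈ᵥ Y → pairᵥ a b ∈ᵥ X ⊗ᵥ Y
∈-⊗ᵥ⁺ (sup A f) (sup B g) (i , a≐) (j , b≐) = (i , j) , pairᵥ-cong a≐ b≐

x∈p─q⁻ : ∀ {k} {x : Fin k} (p q : Subset k) → x ∈ p ─ q → x ∈ p × x ∉ q
x∈p─q⁻ (inside ∷ p) (outside ∷ q) here = here , λ ()
x∈p─q⁻ {x = zero} (inside ∷ p) (inside ∷ q) ()
x∈p─q⁻ {x = zero} (outside ∷ p) (inside ∷ q) ()
x∈p─q⁻ {x = zero} (outside ∷ p) (outside ∷ q) ()
x∈p─q⁻ (s ∷ p) (t ∷ q) (there x∈p─q) =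
  let (x∈p , x∉q) = x∈p─q⁻ p q x∈p─q in there x∈p , λ { (there x∈q) → x∉q x∈q }

x∈p─q⁺ : ∀ {k} {x : Fin k} {p q : Subset k} → x ∈ p → x ∉ q → x ∈ p ─ q
x∈p─q⁺ {q = inside ∷ q} here x∉q = ⊥-elim (x∉q here)
x∈p─q⁺ {q = outside ∷ q} here x∉q = here
x∈p─q⁺ {q = t ∷ q} (there x∈p) x∉q = there (x∈p─q⁺ x∈p (x∉q ∘ there))

bit : Bool → Fin 2
bit false = zero
bit true  = suc zero

bit-injective : ∀ {b c} → bit b ≡ bit c → b ≡ c
bit-injective {false} {false} _ = refl
bit-injective {true}  {true}  _ = refl

encode : ∀ {n} → Subset n → Fin (2 ^ n)
encode []      = zero
encode (b ∷ s) = combine (bit b) (encode s)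

encode-injective : ∀ {n} (s t : Subset n) → encode s ≡ encode t → s ≡ t
encode-injective [] [] _ = refl
encode-injective (b ∷ s) (c ∷ t) eq =
  let (b≡c , s≡t) = combine-injective (bit b) (encode s) (bit c) (encode t) eq
  in subst (λ c → b ∷ s ≡ c ∷ t) (bit-injective b≡c) (cong (b ∷_) (encode-injective s t s≡t))

punchOutPred : ∀ {N} {i j : Fin N} → i ≢ j → Fin (N ∸ 1)
punchOutPred {suc N} = punchOut

punchOutPred-cong : ∀ {N} {i j k : Fin N} {i≢j : i ≢ j} {i≢k : i ≢ k} →
                    j ≡ k → punchOutPred i≢j ≡ punchOutPred i≢k
punchOutPred-cong {suc N} {i} = punchOut-cong i

punchOutPred-injective : ∀ {N} {i j k : Fin N} (i≢j : i ≢ j) (i≢k : i ≢ k) →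
                         punchOutPred i≢j ≡ punchOutPred i≢k → j ≡ k
punchOutPred-injective {suc N} = punchOut-injective

module Classical (lem : ExcludedMiddle 0ℓ) where

  ⟦_⟧ : ∀ {m} → (Fin m → Set) → Subset m
  ⟦ P ⟧ = tabulate λ p → does (lem {P p})

  ∈⟦⟧⁺ : ∀ {m} {P : Fin m → Set} {p} → P p → p ∈ ⟦ P ⟧
  ∈⟦⟧⁺ {P = P} {p} Pp = lookup⇒[]= p _ (trans (lookup∘tabulate _ p) (dec-true lem Pp))

  ∈⟦⟧⁻ : ∀ {m} {P : Fin m → Set} {p} → p ∈ ⟦ P ⟧ → P p
  ∈⟦⟧⁻ {P = P} {p} p∈ with lem {P p} | trans (sym (lookup∘tabulate _ p)) ([]=⇒lookup p∈)
  ... | yes Pp | _ = Pp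
  ... | no _   | ()

module Regions (lem : ExcludedMiddle 0ℓ) {n} (M : Fin n → V) where

  open Classical lem

  Member : Set
  Member = Σ (Fin n) λ i → idx (M i)

  elem : Member → V
  elem (i , a) = el (M i) a

  -- A labelling may split regions but never merges two of them.
  record Labelling (m : ℕ) : Set where
    field
      code       : Member → Fin m
      code-cong  : ∀ {e e′} → elem e ≐ elem e′ → code e ≡ code e′
      code-sound : ∀ {e e′} → code e ≡ code e′ → ∀ j → elem e ∈ᵥ M j → elem e′ ∈ᵥ M j

  signature : V → Subset n
  signature w = ⟦ (λ j → w ∈ᵥ M j) ⟧

  ∈-signature⁺ : ∀ {w j} → w ∈ᵥ M j → j ∈ signature w
  ∈-signature⁺ = ∈⟦⟧⁺

  ∈-signature⁻ : ∀ {w j} → j ∈ signature w → w ∈ᵥ M j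
  ∈-signature⁻ = ∈⟦⟧⁻

  signature-cong : ∀ {w w′} → w ≐ w′ → signature w ≡ signature w′
  signature-cong w≐w′ = ⊆-antisym
    (∈-signature⁺ ∘ ∈ᵥ-respˡ w≐w′ ∘ ∈-signature⁻)
    (∈-signature⁺ ∘ ∈ᵥ-respˡ (≐-sym w≐w′) ∘ ∈-signature⁻)

  member-signature-nonempty : ∀ e → encode {n} ⊥ ≢ encode (signature (elem e))
  member-signature-nonempty (i , a) eq =
    ∉⊥ (subst (i ∈_) (sym (encode-injective _ _ eq)) (∈-signature⁺ (el-∈ (M i) a)))

  -- the empty region is not a place: punch its code out
  regionCode : Member → Fin (2 ^ n ∸ 1)
  regionCode e = punchOutPred (member-signature-nonempty e)

  signatureLabelling : Labelling (2 ^ n ∸ 1)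
  signatureLabelling = record
    { code       = regionCode
    ; code-cong  = λ {e} {e′} e≐e′ →
        punchOutPred-cong {i≢j = member-signature-nonempty e} {member-signature-nonempty e′}
          (cong encode (signature-cong e≐e′))
    ; code-sound = λ eq j e∈ → ∈-signature⁻ (subst (j ∈_) (same-signature eq) (∈-signature⁺ e∈))
    }
    where
    same-signature : ∀ {e e′} → regionCode e ≡ regionCode e′ →
                     signature (elem e) ≡ signature (elem e′)
    same-signature {e} {e′} eq = encode-injective _ _
      (punchOutPred-injective (member-signature-nonempty e) (member-signature-nonempty e′) eq)

  module Graph {m} (L : Labelling m) where

    open Labelling L

    Realizes : Fin m → V → Set
    Realizes p w = Σ Member λ e → code e ≡ p × elem e ≐ w

    realizes-code : ∀ e → Realizes (code e) (elem e)
    realizes-code e = e , refl , ≐-refl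

    realizes-resp : ∀ {p w w′} → w ≐ w′ → Realizes p w → Realizes p w′
    realizes-resp w≐w′ (e , ce , e≐w) = e , ce , ≐-trans e≐w w≐w′

    realizer : ∀ {w x} → w ∈ᵥ M x → ∃ λ p → Realizes p w
    realizer {x = x} w∈ =
      let (a , w≐) = ∈ᵥ⇒el (M x) w∈ in code (x , a) , (x , a) , refl , ≐-sym w≐

    realizes-region : ∀ {p w w′} → Realizes p w → Realizes p w′ → ∀ j → w ∈ᵥ M j → w′ ∈ᵥ M j
    realizes-region (e , ce , e≐w) (e′ , ce′ , e′≐w′) j w∈ =
      ∈ᵥ-respˡ e′≐w′ (code-sound (trans ce (sym ce′)) j (∈ᵥ-respˡ (≐-sym e≐w) w∈))

    F : Fin n → Subset m
    F x = ⟦ (λ p → Σ (idx (M x)) λ a → code (x , a) ≡ p) ⟧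

    ∈F⁺ : ∀ {p w x} → Realizes p w → w ∈ᵥ M x → p ∈ F x
    ∈F⁺ {x = x} (e , ce , e≐w) w∈ =
      let (a , w≐) = ∈ᵥ⇒el (M x) w∈ in ∈⟦⟧⁺ (a , trans (code-cong (≐-sym (≐-trans e≐w w≐))) ce)

    ∈F⁻ : ∀ {p w x} → Realizes p w → p ∈ F x → w ∈ᵥ M x
    ∈F⁻ {x = x} r p∈ =
      let (a , ca) = ∈⟦⟧⁻ p∈ in realizes-region ((x , a) , ca , ≐-refl) r x (el-∈ (M x) a)

    F-witness : ∀ {p x} → p ∈ F x → ∃ λ w → Realizes p w × w ∈ᵥ M x
    F-witness {x = x} p∈ =
      let (a , ca) = ∈⟦⟧⁻ p∈ in el (M x) a , ((x , a) , ca , ≐-refl) , el-∈ (M x) a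

    F-mono : ∀ {x x′} → (∀ {w} → w ∈ᵥ M x → w ∈ᵥ M x′) → F x ⊆ F x′
    F-mono M⊆ p∈ = let (w , r , w∈) = F-witness p∈ in ∈F⁺ r (M⊆ w∈)

    F-∪ : ∀ {x y z} → M x ≐ M y ∪ᵥ M z → F x ≡ F y ∪ F z
    F-∪ {x} {y} {z} E = ⊆-antisym
      (λ p∈ → let (w , r , w∈) = F-witness p∈ in
        x∈p∪q⁺ (Sum.map (∈F⁺ r) (∈F⁺ r) (∈-∪ᵥ⁻ (M y) (M z) (∈ᵥ-respʳ E w∈))))
      (Sum.[ F-mono (into ∘ inj₁) , F-mono (into ∘ inj₂) ]′ ∘ x∈p∪q⁻ (F y) (F z))
      where
      into : ∀ {w} → w ∈ᵥ M y ⊎ w ∈ᵥ M z → w ∈ᵥ M x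
      into = ∈ᵥ-respʳ (≐-sym E) ∘ ∈-∪ᵥ⁺ (M y) (M z)

    F-∖ : ∀ {x y z} → M x ≐ M y ∖ᵥ M z → F x ≡ F y ─ F z
    F-∖ {x} {y} {z} E = ⊆-antisym
      (λ p∈ → let (w , r , w∈) = F-witness p∈
                  (w∈y , w∉z) = ∈-∖ᵥ⁻ (M y) (M z) (∈ᵥ-respʳ E w∈)
              in x∈p─q⁺ (∈F⁺ r w∈y) (w∉z ∘ ∈F⁻ r))
      (λ p∈ → let (p∈y , p∉z) = x∈p─q⁻ (F y) (F z) p∈
                  (w , r , w∈y) = F-witness p∈y
              in ∈F⁺ r (∈ᵥ-respʳ (≐-sym E) (∈-∖ᵥ⁺ (M y) (M z) w∈y (p∉z ∘ ∈F⁺ r))))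

    F-reflects-⊆ : ∀ {x y w} → F x ⊆ F y → w ∈ᵥ M x → w ∈ᵥ M y
    F-reflects-⊆ F⊆ w∈ = let (p , r) = realizer w∈ in ∈F⁻ r (F⊆ (∈F⁺ r w∈))

    F-reflects-≐ : ∀ {x y} → F x ≡ F y → M x ≐ M y
    F-reflects-≐ eq = ≐-ext (F-reflects-⊆ (⊆-reflexive eq)) (F-reflects-⊆ (⊆-reflexive (sym eq)))

    -- The witnessing literal x = y ⊗ z matters: it forces every element of a
    -- targeted region to be a pair (see realizer-is-pair).
    Node : Fin m → Fin m → Fin m → Set
    Node u v p = Σ (Fin n) λ x → Σ (Fin n) λ y → Σ (Fin n) λ z → M x ≐ M y ⊗ᵥ M z ×
      Σ (idx (M y)) λ a → Σ (idx (M z)) λ b → code (y , a) ≡ u × code (z , b) ≡ v ×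
        Realizes p (pairᵥ (el (M y) a) (el (M z) b))

    T : Target m
    T u v = ⟦ (λ p → Node u v p ⊎ Node v u p) ⟧

    T-sym : Symmetric T
    T-sym u v = ⊆-antisym (∈⟦⟧⁺ ∘ Sum.swap ∘ ∈⟦⟧⁻) (∈⟦⟧⁺ ∘ Sum.swap ∘ ∈⟦⟧⁻)

    Node⇒pair : ∀ {u v p} → Node u v p →
                ∃₂ λ a b → Realizes u a × Realizes v b × Realizes p (pairᵥ a b)
    Node⇒pair (_ , y , z , _ , a , b , ca , cb , r) =
      _ , _ , ((y , a) , ca , ≐-refl) , ((z , b) , cb , ≐-refl) , r

    ∈T⇒pair : ∀ {u v p} → p ∈ T u v →
              ∃₂ λ a b → Realizes u a × Realizes v b × Realizes p (pairᵥ a b)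
    ∈T⇒pair p∈ with ∈⟦⟧⁻ p∈
    ... | inj₁ node = Node⇒pair node
    ... | inj₂ node =
      let (b , a , rb , ra , r) = Node⇒pair node in a , b , ra , rb , realizes-resp (pairᵥ-comm b a) r

    ∈F-el : ∀ {s c x} {d : idx (M x)} → Realizes s c → c ≐ el (M x) d → s ∈ F x
    ∈F-el {x = x} {d} r c≐ = ∈F⁺ r (∈ᵥ-respˡ (≐-sym c≐) (el-∈ (M x) d))

    pair∈⊗⇒NodeIn⊗ : ∀ {s t a b y z} → Realizes s a → Realizes t b →
                     pairᵥ a b ∈ᵥ M y ⊗ᵥ M z → NodeIn⊗ (F y) (F z) s t
    pair∈⊗⇒NodeIn⊗ {y = y} {z} ra rb ab∈ with ∈-⊗ᵥ⁻ (M y) (M z) ab∈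
    ... | a′ , b′ , ab≐ with pairᵥ-injective ab≐
    ...   | inj₁ (a≐ , b≐) = inj₁ (∈F-el ra a≐ , ∈F-el rb b≐)
    ...   | inj₂ (a≐ , b≐) = inj₂ (∈F-el rb b≐ , ∈F-el ra a≐)

    module _ {x y z} (E : M x ≐ M y ⊗ᵥ M z) where

      T-nonempty : ∀ {u v} → u ∈ F y → v ∈ F z → Nonempty (T u v)
      T-nonempty u∈ v∈ =
        let (a , ca) = ∈⟦⟧⁻ u∈
            (b , cb) = ∈⟦⟧⁻ v∈
            (p , r) = realizer (∈ᵥ-respʳ (≐-sym E) (∈-⊗ᵥ⁺ (M y) (M z) (el-∈ _ a) (el-∈ _ b)))
        in p , ∈⟦⟧⁺ (inj₁ (x , y , z , E , a , b , ca , cb , r))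

      T⊆F : ∀ {u v} → u ∈ F y → v ∈ F z → T u v ⊆ F x
      T⊆F u∈ v∈ p∈ =
        let (a , b , ra , rb , r) = ∈T⇒pair p∈
        in ∈F⁺ r (∈ᵥ-respʳ (≐-sym E) (∈-⊗ᵥ⁺ (M y) (M z) (∈F⁻ ra u∈) (∈F⁻ rb v∈)))

      F⊆⋃T : ∀ p → p ∈ F x → ∃[ u ] ∃[ v ] (u ∈ F y × v ∈ F z × p ∈ T u v)
      F⊆⋃T p p∈ =
        let (c , cc) = ∈⟦⟧⁻ p∈
            (a , b , c≐) = ∈-⊗ᵥ⁻ (M y) (M z) (∈ᵥ-respʳ E (el-∈ (M x) c))
        in code (y , a) , code (z , b) , ∈⟦⟧⁺ (a , refl) , ∈⟦⟧⁺ (b , refl) ,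
           ∈⟦⟧⁺ (inj₁ (x , y , z , E , a , b , refl , refl , (x , c) , cc , c≐))

      T-disjoint : ∀ u v p → ¬ NodeIn⊗ (F y) (F z) u v → p ∈ T u v → p ∉ F x
      T-disjoint u v p ¬node p∈T p∈F =
        let (a , b , ra , rb , r) = ∈T⇒pair p∈T
        in ¬node (pair∈⊗⇒NodeIn⊗ ra rb (∈ᵥ-respʳ E (∈F⁻ r p∈F)))

    fulfills : ∀ {ℓ} → HoldsV M ℓ → FulfillsLit T F ℓ
    fulfills {unionL x y z}  = F-∪
    fulfills {diffL x y z}   = F-∖
    fulfills {otimesL x y z} E =
      (λ u v u∈ v∈ → T-nonempty E u∈ v∈ , T⊆F E u∈ v∈) , F⊆⋃T E , T-disjoint E
    fulfills {neqL x y} M≉ = M≉ ∘ F-reflects-≐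

    Targeted : Fin m → Set
    Targeted p = Σ (Fin m) λ u → Σ (Fin m) λ v → Node u v p

    source-or-targeted : ∀ {p} → (Targeted p → Accessible T p) → Accessible T p
    source-or-targeted {p} targeted⇒ with lem {Targeted p}
    ... | yes t = targeted⇒ t
    ... | no ¬t = source λ u v p∈ →
      ¬t (Sum.[ (λ node → u , v , node) , (λ node → v , u , node) ]′ (∈⟦⟧⁻ p∈))

    realizer-is-pair : ∀ {u v p w} → Node u v p → Realizes p w →
                       ∃₂ λ a b → w ≐ pairᵥ a b × ∃₂ λ s t → Realizes s a × Realizes t b × p ∈ T s t
    realizer-is-pair (x , y , z , E , a′ , b′ , _ , _ , r′) r =
      let a′b′∈x = ∈ᵥ-respʳ (≐-sym E) (∈-⊗ᵥ⁺ (M y) (M z) (el-∈ _ a′) (el-∈ _ b′))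
          w∈x = realizes-region r′ r x a′b′∈x
          (a , b , w≐) = ∈-⊗ᵥ⁻ (M y) (M z) (∈ᵥ-respʳ E w∈x)
      in el (M y) a , el (M z) b , w≐ , code (y , a) , code (z , b) ,
         realizes-code (y , a) , realizes-code (z , b) ,
         ∈⟦⟧⁺ (inj₁ (x , y , z , E , a , b , refl , refl , realizes-resp w≐ r))

    accessible-realized : ∀ w {p} → Realizes p w → Accessible T p
    accessible-realized (sup A f) r = source-or-targeted λ (_ , _ , node) →
      let (a , b , w≐ , s , t , ra , rb , p∈) = realizer-is-pair node r
          (i , a≐) = ∈ᵥ-respʳ (≐-sym w≐) (∈-pairᵥˡ a b)
          (j , b≐) = ∈ᵥ-respʳ (≐-sym w≐) (∈-pairᵥʳ a b)
      in step (accessible-realized (f i) (realizes-resp a≐ ra))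
              (accessible-realized (f j) (realizes-resp b≐ rb)) p∈

    accessible : AccessibleGraph T
    accessible p = source-or-targeted λ (_ , _ , node) →
      let (_ , _ , _ , _ , r) = Node⇒pair node in accessible-realized _ r

corollary1 : ExcludedMiddle 0ℓ → ∀ n (Φ : Conjunction n) → Satisfiable Φ →
    ∃[ m ] (m ≤ 2 ^ n ∸ 1 × Σ (Target m) λ T →
      Symmetric T × AccessibleGraph T × Fulfills T Φ)
corollary1 lem n Φ (M , holds) =
  2 ^ n ∸ 1 , ≤-refl , T , T-sym , accessible , F , All.map fulfills holds
  where
  open Regions lem M
  open Graph signatureLabelling
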